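{- For all integers $r \geq 3$, $s \geq 0$ and all sufficiently large integers $n$, $$\mathrm{tsat}(n+s,K_{r+s}) \leq \mathrm{tsat}(n,K_r) + sn + \binom{s}{2}.$$
   Context: All graphs are finite and simple. Two distinct vertices are twins if they have the same neighbourhood; a graph is twin-free if it has no pair of twins. A graph is $K_r$-saturated if it contains no $K_r$ but adding any missing edge creates a $K_r$. For $r\ge3$ and large $n$, $\mathrm{tsat}(n,K_r)$ is the minimum number of edges in a twin-free $K_r$-saturated graph on $n$ vertices. -}

module Defs where

open import Data.Nat using (ℕ; _+_; _<ᵇ_; _≤_)
open import Data.Fin using (Fin; toℕ; _≟_)
open import Data.Bool using (Bool; true; false; _∧_; _∨_; if_then_else_)
open import Data.List using (map; allFin)
open import Data.Nat.ListAction using (sum)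
open import Data.Product using (_×_; Σ)
open import Relation.Nullary using (¬_; Dec; yes; no)
open import Relation.Binary.PropositionalEquality using (_≡_; _≢_)

record Graph (n : ℕ) : Set where
  field
    adj   : Fin n → Fin n → Bool
    sym   : ∀ u v → adj u v ≡ adj v u
    irrefl : ∀ u → adj u u ≡ false
open Graph public

edges : ∀ {n} → Graph n → ℕ
edges {n} G =
  sum (map (λ i → sum (map (λ j → if adj G i j ∧ (toℕ i <ᵇ toℕ j) then 1 else 0)
                                   (allFin n)))
           (allFin n))

HasClique : ∀ {n} → ℕ → (Fin n → Fin n → Bool) → Set
HasClique {n} r a =
  Σ (Fin r → Fin n) λ f →
    (∀ x y → f x ≡ f y → x ≡ y) × (∀ x y → x ≢ y → a (f x) (f y) ≡ true)

addEdge : ∀ {n} → (Fin n → Fin n → Bool) → Fin n → Fin n → Fin n → Fin n → Bool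
addEdge a u v x y with x ≟ u | y ≟ v | x ≟ v | y ≟ u
... | yes _ | yes _ | _     | _     = true
... | _     | _     | yes _ | yes _ = true
... | _     | _     | _     | _     = a x y

Saturated : ∀ {n} → ℕ → Graph n → Set
Saturated r G =
  ¬ HasClique r (adj G) ×
  (∀ u v → u ≢ v → adj G u v ≡ false → HasClique r (addEdge (adj G) u v))

Twins : ∀ {n} → Graph n → Fin n → Fin n → Set
Twins G u v = u ≢ v × (∀ w → adj G u w ≡ adj G v w)

TwinFree : ∀ {n} → Graph n → Set
TwinFree G = ∀ u v → ¬ Twins G u v

IsTsat : ℕ → ℕ → ℕ → Set
IsTsat n r k =
  Σ (Graph n) (λ G → TwinFree G × Saturated r G × edges G ≡ k) ×
  (∀ (G : Graph n) → TwinFree G → Saturated r G → k ≤ edges G)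

{-# OPTIONS --safe #-}
-- Adding a universal vertex preserves twin-freeness, turns a K_r-saturated graph into a
-- K_(r+1)-saturated one (a clique uses the new vertex at most once, and every missing edge
-- still lies in the base graph), and adds one edge per old vertex.  Adding s universal
-- vertices to an extremal graph for tsat(n, K_r) thus gives a twin-free K_(r+s)-saturated
-- graph with t + s n + C(s, 2) edges.  That a minimum on n + s vertices is attained is
-- witnessed constructively by exhaustive search over the finitely many graphs.
module Submission where

open import Defs
open import Level using (0ℓ)
open import Data.Bool as Bool using (Bool; true; false; _∧_; _∨_; if_then_else_)
open import Data.Bool.Properties using (∨-zeroʳ)
open import Data.Empty using (⊥-elim)
open import Data.Fin using (Fin; zero; suc; toℕ; _≟_; punchIn; punchOut)
open import Data.Fin.Properties
  using ( all?; any?; suc-injective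
        ; punchIn-injective; punchInᵢ≢i; punchOut-injective; punchIn-punchOut)
open import Data.List using (map; allFin)
open import Data.List.Properties using (map-tabulate; map-cong)
open import Data.Nat as ℕ using (ℕ; zero; suc; _+_; _*_; _≤_; _<_; _<ᵇ_)
open import Data.Nat.Combinatorics using (_C_; nC1≡n; nCk+nC[k+1]≡[n+1]C[k+1])
open import Data.Nat.Induction using (<-rec)
open import Data.Nat.ListAction using (sum)
open import Data.Nat.Properties
  using (anyUpTo?; ≮⇒≥; +-comm; +-identityʳ; ≤-trans; ≤-reflexive)
open import Data.Nat.Solver using (module +-*-Solver)
open import Data.Product using (Σ; ∃; _×_; _,_; proj₁; proj₂)
open import Data.Vec.Functional using (Vector; []; _∷_; head; tail)
open import Data.Vec.Functional.Relation.Binary.Pointwise using (Pointwise)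
open import Function using (id; _∘_; _on_)
open import Relation.Binary using (Rel; Reflexive; _Respects_; _Preserves_⟶_)
open import Relation.Binary.PropositionalEquality as ≡
  using (_≡_; _≢_; refl; trans; cong; cong₂; subst₂; module ≡-Reasoning)
open import Relation.Nullary using (Dec; yes; no; does; ¬?)
open import Relation.Nullary.Decidable as Dec using (_×-dec_; _⊎-dec_; _→-dec_)
open import Relation.Unary using (Pred; Decidable)

private
  variable
    n r : ℕ

-- Predicates must respect _≈_: without function extensionality, searching a function
-- space recovers a witness only up to pointwise equality.
Searchable : (A : Set) → Rel A 0ℓ → Set₁
Searchable A _≈_ = ∀ {P : Pred A 0ℓ} → Decidable P → P Respects _≈_ → Dec (∃ P)

Bool-searchable : Searchable Bool _≡_
Bool-searchable P? _ with P? true | P? false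
... | yes p  | _      = yes (true , p)
... | _      | yes p  = yes (false , p)
... | no ¬pt | no ¬pf = no λ { (true , p) → ¬pt p ; (false , p) → ¬pf p }

Fin-searchable : ∀ n → Searchable (Fin n) _≡_
Fin-searchable n P? _ = any? P?

module _ {A : Set} {_≈_ : Rel A 0ℓ}
         (≈-refl : Reflexive _≈_) (search : Searchable A _≈_) where

  private
    ∷-cong : ∀ {k x y} {xs ys : Vector A k} →
             x ≈ y → Pointwise _≈_ xs ys → Pointwise _≈_ (x ∷ xs) (y ∷ ys)
    ∷-cong x≈y _     zero    = x≈y
    ∷-cong _   xs≈ys (suc i) = xs≈ys i

    ∷-η : ∀ {k} (xs : Vector A (suc k)) → Pointwise _≈_ xs (head xs ∷ tail xs)
    ∷-η xs zero    = ≈-refl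
    ∷-η xs (suc i) = ≈-refl

  Vector-searchable : ∀ k → Searchable (Vector A k) (Pointwise _≈_)
  Vector-searchable zero P? P-resp =
    Dec.map′ ([] ,_) (λ (xs , p) → P-resp (λ ()) p) (P? [])
  Vector-searchable (suc k) {P} P? P-resp =
    Dec.map′ (λ (x , xs , p) → x ∷ xs , p)
             (λ (xs , p) → head xs , tail xs , P-resp (∷-η xs) p)
             (search Q? Q-resp)
    where
    Q : Pred A 0ℓ
    Q x = ∃ λ xs → P (x ∷ xs)
    Q? : Decidable Q
    Q? x = Vector-searchable k (P? ∘ (x ∷_)) (P-resp ∘ ∷-cong ≈-refl)
    Q-resp : Q Respects _≈_
    Q-resp x≈y (xs , p) = xs , P-resp (∷-cong x≈y (λ i → ≈-refl)) p

Least : Pred ℕ 0ℓ → Pred ℕ 0ℓ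
Least P k = P k × ∀ {j} → P j → k ≤ j

least : ∀ {P : Pred ℕ 0ℓ} → Decidable P → ∀ {n} → P n → ∃ (Least P)
least {P} P? {n} = <-rec (λ n → P n → ∃ (Least P)) step n
  where
  step : ∀ n → (∀ {m} → m < n → P m → ∃ (Least P)) → P n → ∃ (Least P)
  step n below pn with anyUpTo? P? n
  ... | yes (m , m<n , pm) = below m<n pm
  ... | no none            = n , pn , λ pj → ≮⇒≥ λ j<n → none (_ , j<n , pj)

module _ {A : Set} {_≈_ : Rel A 0ℓ} (search : Searchable A _≈_)
         (μ : A → ℕ) (μ-cong : μ Preserves _≈_ ⟶ _≡_) where

  minimiser : ∀ {P : Pred A 0ℓ} → Decidable P → P Respects _≈_ → ∃ P →
              ∃ λ y → P y × ∀ z → P z → μ y ≤ μ z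
  minimiser {P} P? P-resp (x , px) with least attained? (x , px , refl)
    where
    attained? : Decidable (λ k → ∃ λ y → P y × μ y ≡ k)
    attained? k = search (λ y → P? y ×-dec μ y ℕ.≟ k)
      (λ x≈y (px , μx≡k) → P-resp x≈y px , trans (≡.sym (μ-cong x≈y)) μx≡k)
  ... | _ , (y , py , refl) , minimal = y , py , λ z pz → minimal (z , pz , refl)

Adjacency : ℕ → Set
Adjacency n = Fin n → Fin n → Bool

_≈ₐ_ : Rel (Adjacency n) 0ℓ
_≈ₐ_ = Pointwise (Pointwise _≡_)

Adjacency-searchable : ∀ n → Searchable (Adjacency n) _≈ₐ_
Adjacency-searchable n =
  Vector-searchable (λ _ → refl) (Vector-searchable refl Bool-searchable n) n

IsClique : Adjacency n → (Fin r → Fin n) → Set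
IsClique a f =
  (∀ x y → f x ≡ f y → x ≡ y) × (∀ x y → x ≢ y → a (f x) (f y) ≡ true)

isClique? : (a : Adjacency n) → Decidable (IsClique {r = r} a)
isClique? a f =
  all? (λ x → all? λ y → (f x ≟ f y) →-dec (x ≟ y)) ×-dec
  all? (λ x → all? λ y → ¬? (x ≟ y) →-dec (a (f x) (f y) Bool.≟ true))

isClique-resp : (a : Adjacency n) → IsClique {r = r} a Respects Pointwise _≡_
isClique-resp a f≗g (injective , adjacent) =
  (λ x y gx≡gy → injective x y (trans (f≗g x) (trans gx≡gy (≡.sym (f≗g y))))) ,
  (λ x y x≢y → trans (cong₂ a (≡.sym (f≗g x)) (≡.sym (f≗g y))) (adjacent x y x≢y))

hasClique? : ∀ r (a : Adjacency n) → Dec (HasClique r a)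
hasClique? {n} r a = Vector-searchable refl (Fin-searchable n) r (isClique? a) (isClique-resp a)

hasClique-resp : HasClique r Respects (_≈ₐ_ {n})
hasClique-resp a≈b (f , injective , adjacent) =
  f , injective , λ x y x≢y → trans (≡.sym (a≈b (f x) (f y))) (adjacent x y x≢y)

addEdge-∨ : ∀ (a : Adjacency n) u v x y →
  addEdge a u v x y ≡ does ((x ≟ u ×-dec y ≟ v) ⊎-dec (x ≟ v ×-dec y ≟ u)) ∨ a x y
addEdge-∨ a u v x y with x ≟ u | y ≟ v | x ≟ v | y ≟ u
... | yes _ | yes _ | _     | _     = refl
... | yes _ | no _  | yes _ | yes _ = refl
... | yes _ | no _  | yes _ | no _  = refl
... | yes _ | no _  | no _  | _     = refl
... | no _  | _     | yes _ | yes _ = refl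
... | no _  | _     | yes _ | no _  = refl
... | no _  | _     | no _  | _     = refl

addEdge-cong : ∀ {a b : Adjacency n} u v → a ≈ₐ b → addEdge a u v ≈ₐ addEdge b u v
addEdge-cong {a = a} {b} u v a≈b x y = begin
  addEdge a u v x y  ≡⟨ addEdge-∨ a u v x y ⟩
  _ ∨ a x y          ≡⟨ cong (_ ∨_) (a≈b x y) ⟩
  _ ∨ b x y          ≡⟨ ≡.sym (addEdge-∨ b u v x y) ⟩
  addEdge b u v x y  ∎
  where open ≡-Reasoning

private
  ∑ : (Fin n → ℕ) → ℕ
  ∑ {n} f = sum (map f (allFin n))

  ∑-suc : (f : Fin (suc n) → ℕ) → ∑ f ≡ f zero + ∑ (f ∘ suc)
  ∑-suc f = cong (λ xs → f zero + sum xs)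
    (trans (map-tabulate suc f) (≡.sym (map-tabulate id (f ∘ suc))))

  ∑-cong : {f g : Fin n → ℕ} → (∀ i → f i ≡ g i) → ∑ f ≡ ∑ g
  ∑-cong {n} f≗g = cong sum (map-cong f≗g (allFin n))

  edge? : Adjacency n → Fin n → Fin n → ℕ
  edge? a i j = if a i j ∧ (toℕ i <ᵇ toℕ j) then 1 else 0

  ∑-1 : ∀ n → ∑ {n} (λ _ → 1) ≡ n
  ∑-1 zero    = refl
  ∑-1 (suc n) = trans (∑-suc {n} (λ _ → 1)) (cong suc (∑-1 n))

_≈ᴳ_ : Rel (Graph n) 0ℓ
_≈ᴳ_ = _≈ₐ_ on adj

Graph-searchable : ∀ n → Searchable (Graph n) _≈ᴳ_
Graph-searchable n {P} P? P-resp =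
  Dec.map′ (λ (a , s , i , p) → record { adj = a ; sym = s ; irrefl = i } , p)
           (λ (G , p) → adj G , sym G , irrefl G , p)
           (Adjacency-searchable n Q? Q-resp)
  where
  Q : Pred (Adjacency n) 0ℓ
  Q a = Σ (∀ u v → a u v ≡ a v u) λ s → Σ (∀ u → a u u ≡ false) λ i →
        P (record { adj = a ; sym = s ; irrefl = i })
  Q? : Decidable Q
  Q? a with all? (λ u → all? λ v → a u v Bool.≟ a v u)
           | all? (λ u → a u u Bool.≟ false)
  ... | no ¬s | _     = no (¬s ∘ proj₁)
  ... | _     | no ¬i = no (¬i ∘ proj₁ ∘ proj₂)
  ... | yes s | yes i =
    Dec.map′ (λ p → s , i , p) (λ (_ , _ , p) → P-resp (λ _ _ → refl) p) (P? _)
  Q-resp : Q Respects _≈ₐ_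
  Q-resp a≈b (s , i , p) =
    (λ u v → trans (≡.sym (a≈b u v)) (trans (s u v) (a≈b v u))) ,
    (λ u → trans (≡.sym (a≈b u u)) (i u)) ,
    P-resp a≈b p

twinFree? : (G : Graph n) → Dec (TwinFree G)
twinFree? G = all? λ u → all? λ v →
  ¬? (¬? (u ≟ v) ×-dec all? λ w → adj G u w Bool.≟ adj G v w)

saturated? : ∀ r (G : Graph n) → Dec (Saturated r G)
saturated? r G = ¬? (hasClique? r (adj G)) ×-dec all? λ u → all? λ v →
  ¬? (u ≟ v) →-dec ((adj G u v Bool.≟ false) →-dec hasClique? r (addEdge (adj G) u v))

twinFree-resp : TwinFree Respects (_≈ᴳ_ {n})
twinFree-resp G≈H twinFree u v (u≢v , sameNbhd) =
  twinFree u v (u≢v , λ w → trans (G≈H u w) (trans (sameNbhd w) (≡.sym (G≈H v w))))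

saturated-resp : Saturated r Respects (_≈ᴳ_ {n})
saturated-resp G≈H (cliqueFree , saturating) =
  cliqueFree ∘ hasClique-resp (λ u v → ≡.sym (G≈H u v)) ,
  λ u v u≢v nonadj →
    hasClique-resp (addEdge-cong u v G≈H) (saturating u v u≢v (trans (G≈H u v) nonadj))

edges-cong : ∀ {G H : Graph n} → G ≈ᴳ H → edges G ≡ edges H
edges-cong G≈H =
  ∑-cong λ u → ∑-cong λ v → cong (λ b → if b ∧ _ then 1 else 0) (G≈H u v)

tsat-exists : ∀ r (G : Graph n) → TwinFree G → Saturated r G →
              ∃ λ t → IsTsat n r t × t ≤ edges G
tsat-exists {n} r G twinFree saturated
  with minimiser (Graph-searchable n) edges (λ {G} {H} → edges-cong {G = G} {H})
         (λ H → twinFree? H ×-dec saturated? r H)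
         (λ {G} {H} G≈H (tf , sat) →
            twinFree-resp {x = G} {H} G≈H tf , saturated-resp {x = G} {H} G≈H sat)
         (G , twinFree , saturated)
... | H , (twinFreeH , saturatedH) , minimal =
  edges H , ((H , twinFreeH , saturatedH , refl) , λ G′ tf sat → minimal G′ (tf , sat)) ,
  minimal G (twinFree , saturated)

coneAdj : Adjacency n → Adjacency (suc n)
coneAdj a zero    zero    = false
coneAdj a zero    (suc _) = true
coneAdj a (suc _) zero    = true
coneAdj a (suc x) (suc y) = a x y

cone : Graph n → Graph (suc n)
cone G = record { adj = coneAdj (adj G) ; sym = coneAdj-sym ; irrefl = coneAdj-irrefl }
  where
  coneAdj-sym : ∀ u v → coneAdj (adj G) u v ≡ coneAdj (adj G) v u
  coneAdj-sym zero    zero    = refl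
  coneAdj-sym zero    (suc _) = refl
  coneAdj-sym (suc _) zero    = refl
  coneAdj-sym (suc x) (suc y) = sym G x y
  coneAdj-irrefl : ∀ u → coneAdj (adj G) u u ≡ false
  coneAdj-irrefl zero    = refl
  coneAdj-irrefl (suc x) = irrefl G x

record IsConeOver (b : Adjacency (suc n)) (a : Adjacency n) : Set where
  field
    apex-adjacentʳ : ∀ x → b zero (suc x) ≡ true
    apex-adjacentˡ : ∀ x → b (suc x) zero ≡ true
    base-adjacency : ∀ x y → b (suc x) (suc y) ≡ a x y

cone-clique : ∀ {b : Adjacency (suc n)} {a} →
              IsConeOver b a → HasClique r a → HasClique (suc r) b
cone-clique {b = b} isCone (f , injective , adjacent) =
  zero ∷ suc ∘ f , injective′ , adjacent′
  where
  open IsConeOver isCone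
  injective′ : ∀ x y → (zero ∷ suc ∘ f) x ≡ (zero ∷ suc ∘ f) y → x ≡ y
  injective′ zero    zero    _ = refl
  injective′ zero    (suc _) ()
  injective′ (suc _) zero    ()
  injective′ (suc x) (suc y) e = cong suc (injective x y (suc-injective e))
  adjacent′ : ∀ x y → x ≢ y → b ((zero ∷ suc ∘ f) x) ((zero ∷ suc ∘ f) y) ≡ true
  adjacent′ zero    zero    x≢y = ⊥-elim (x≢y refl)
  adjacent′ zero    (suc y) _   = apex-adjacentʳ (f y)
  adjacent′ (suc x) zero    _   = apex-adjacentˡ (f x)
  adjacent′ (suc x) (suc y) x≢y =
    trans (base-adjacency (f x) (f y)) (adjacent x y (x≢y ∘ cong suc))

addEdge-coneAdj : ∀ (a : Adjacency n) u v →
                  IsConeOver (addEdge (coneAdj a) (suc u) (suc v)) (addEdge a u v)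
addEdge-coneAdj a u v = record
  { apex-adjacentʳ = λ x → addEdge-∨ (coneAdj a) (suc u) (suc v) zero (suc x)
  ; apex-adjacentˡ = λ x →
      trans (addEdge-∨ (coneAdj a) (suc u) (suc v) (suc x) zero) (∨-zeroʳ _)
  ; base-adjacency = λ x y → trans (addEdge-∨ (coneAdj a) (suc u) (suc v) (suc x) (suc y))
                                   (≡.sym (addEdge-∨ a u v x y))
  }

punctured-clique : ∀ (a : Adjacency n) {f : Fin (suc r) → Fin (suc n)} →
                   IsClique (coneAdj a) f → ∀ i → (∀ j → zero ≢ f (punchIn i j)) →
                   HasClique r a
punctured-clique a (injective , adjacent) i avoids =
  (λ j → punchOut (avoids j)) , injective′ , adjacent′
  where
  injective′ : ∀ j k → punchOut (avoids j) ≡ punchOut (avoids k) → j ≡ k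
  injective′ j k e =
    punchIn-injective i j k (injective _ _ (punchOut-injective (avoids j) (avoids k) e))
  adjacent′ : ∀ j k → j ≢ k → a (punchOut (avoids j)) (punchOut (avoids k)) ≡ true
  adjacent′ j k j≢k =
    trans (cong₂ (coneAdj a) (punchIn-punchOut (avoids j)) (punchIn-punchOut (avoids k)))
          (adjacent _ _ (j≢k ∘ punchIn-injective i j k))

-- Injectivity puts at most one vertex of the clique on the apex.
uncone-clique : ∀ (a : Adjacency n) → HasClique (suc r) (coneAdj a) → HasClique r a
uncone-clique a (f , clique@(injective , _)) with any? (λ i → zero ≟ f i)
... | yes (i , apex≡fi) = punctured-clique a clique i λ j apex≡fj →
  punchInᵢ≢i i j (injective _ _ (trans (≡.sym apex≡fj) apex≡fi))
... | no noApex = punctured-clique a clique zero λ j apex≡fj → noApex (_ , apex≡fj)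

cone-twinFree : (G : Graph n) → TwinFree G → TwinFree (cone G)
cone-twinFree G twinFree zero    zero    (u≢v , _)  = u≢v refl
cone-twinFree G twinFree zero    (suc y) (_ , same)
  with trans (same (suc y)) (irrefl G y)
... | ()
cone-twinFree G twinFree (suc x) zero    (_ , same)
  with trans (≡.sym (irrefl G x)) (same (suc x))
... | ()
cone-twinFree G twinFree (suc x) (suc y) (u≢v , same) =
  twinFree x y (u≢v ∘ cong suc , same ∘ suc)

cone-saturated : (G : Graph n) → Saturated r G → Saturated (suc r) (cone G)
cone-saturated G (cliqueFree , saturating) = cliqueFree ∘ uncone-clique (adj G) , saturating′
  where
  saturating′ : ∀ u v → u ≢ v → coneAdj (adj G) u v ≡ false →
                HasClique _ (addEdge (coneAdj (adj G)) u v)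
  saturating′ zero    zero    u≢v _      = ⊥-elim (u≢v refl)
  saturating′ (suc x) (suc y) u≢v nonadj =
    cone-clique (addEdge-coneAdj (adj G) x y) (saturating x y (u≢v ∘ cong suc) nonadj)

edges-cone : (G : Graph n) → edges (cone G) ≡ n + edges G
edges-cone {n} G = begin
  edges (cone G)
    ≡⟨ ∑-suc (λ i → ∑ (edge? a′ i)) ⟩
  ∑ (edge? a′ zero) + ∑ (λ i → ∑ (edge? a′ (suc i)))
    ≡⟨ cong₂ _+_ apex-row base-rows ⟩
  n + edges G
    ∎
  where
  open ≡-Reasoning
  a′ : Adjacency (suc n)
  a′ = coneAdj (adj G)
  apex-row : ∑ (edge? a′ zero) ≡ n
  apex-row = trans (∑-suc (edge? a′ zero)) (∑-1 n)
  base-rows : ∑ (λ i → ∑ (edge? a′ (suc i))) ≡ edges G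
  base-rows = ∑-cong λ i → ∑-suc (edge? a′ (suc i))

cones : ∀ s → Graph n → Graph (s + n)
cones zero    G = G
cones (suc s) G = cone (cones s G)

cones-twinFree : ∀ s (G : Graph n) → TwinFree G → TwinFree (cones s G)
cones-twinFree zero    G twinFree = twinFree
cones-twinFree (suc s) G twinFree = cone-twinFree (cones s G) (cones-twinFree s G twinFree)

cones-saturated : ∀ s (G : Graph n) → Saturated r G → Saturated (s + r) (cones s G)
cones-saturated zero    G saturated = saturated
cones-saturated (suc s) G saturated = cone-saturated (cones s G) (cones-saturated s G saturated)

[n+1]C2≡n+nC2 : ∀ s → suc s C 2 ≡ s + s C 2
[n+1]C2≡n+nC2 s = begin
  suc s C 2        ≡⟨ ≡.sym (nCk+nC[k+1]≡[n+1]C[k+1] s 1) ⟩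
  s C 1 + s C 2    ≡⟨ cong (_+ s C 2) (nC1≡n s) ⟩
  s + s C 2        ∎
  where open ≡-Reasoning

edges-cones : ∀ s (G : Graph n) → edges (cones s G) ≡ edges G + s * n + s C 2
edges-cones zero G = ≡.sym (trans (+-identityʳ _) (+-identityʳ _))
edges-cones {n} (suc s) G = begin
  edges (cone (cones s G))              ≡⟨ edges-cone (cones s G) ⟩
  s + n + edges (cones s G)             ≡⟨ cong (s + n +_) (edges-cones s G) ⟩
  s + n + (edges G + s * n + s C 2)     ≡⟨ regroup (edges G) n s (s C 2) ⟩
  edges G + (n + s * n) + (s + s C 2)   ≡⟨ cong (edges G + (n + s * n) +_) ([n+1]C2≡n+nC2 s) ⟨
  edges G + suc s * n + suc s C 2       ∎
  where
  open ≡-Reasoning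
  regroup : ∀ e n s c → s + n + (e + s * n + c) ≡ e + (n + s * n) + (s + c)
  regroup = solve 4 (λ e n s c → s :+ n :+ (e :+ s :* n :+ c)
                               := e :+ (n :+ s :* n) :+ (s :+ c)) refl
    where open +-*-Solver

tsat-join : ∀ {n r t} s → IsTsat n r t →
            ∃ λ t′ → IsTsat (n + s) (r + s) t′ × t′ ≤ t + s * n + s C 2
tsat-join {n} {r} s ((G , twinFree , saturated , refl) , _) =
  let t′ , tsat , t′≤ = tsat-exists (s + r) (cones s G)
                          (cones-twinFree s G twinFree) (cones-saturated s G saturated)
  in t′ , subst₂ (λ m k → IsTsat m k t′) (+-comm s n) (+-comm s r) tsat ,
     ≤-trans t′≤ (≤-reflexive (edges-cones s G))

-- The bound holds for every n at which tsat(n, K_r) is attained.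
lemma17 : ∀ (r s : ℕ) → 3 ≤ r →
    Σ ℕ λ N → ∀ (n : ℕ) → N ≤ n →
      ∀ (t : ℕ) → IsTsat n r t →
        Σ ℕ λ t' → IsTsat (n + s) (r + s) t' × t' ≤ t + s * n + s C 2
lemma17 r s _ = 0 , λ n _ t → tsat-join s
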